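{- In $\mathbf{Z}_{47}$ define $P_1=\{0,2,4,5,9,10,12,16,17,19,21,22,23,25,27,28,35,36,37,43,46\}$, $P_2=\{0,1,2,6,8,9,11,15,16,19,25,32,33,35,36,37,38,40,44\}$, $P_3=\{1,2,3,4,5,6,7,10,11,16,18,22,24,28,31,35,38,40,43\}$, $Q_1=\{4,5,6,8,11,12,15,20,21,23,25,26,28,29,30,31,32,36,39,41,43\}$, $Q_2=\{1,2,5,7,13,14,21,22,24,26,31,32,35,36,37,39,40,42,46\}$, $Q_3=\{1,2,3,4,5,9,12,18,20,21,24,25,32,34,38,39,43,44,46\}$. Then $\{P_1,P_2,P_3\}$ and $\{Q_1,Q_2,Q_3\}$ are both $3$-$(47;21,19,19;24)$ supplementary difference sets in $\mathbf{Z}_{47}$, and these two families are not equivalent to each other.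
   Context: $\mathbf{Z}_n$ denotes the additive group of integers modulo $n$. A family of subsets $S_1,\dots,S_t$ of $\mathbf{Z}_n$ with $|S_k|=n_k$ is a $t$-$(n;n_1,\dots,n_t;\lambda)$ supplementary difference set (difference family) if for every nonzero $r\in\mathbf{Z}_n$, the total number of ordered pairs $(i,j)$ with $i,j\in S_k$ for some $k$ and $i-j\equiv r \pmod n$, counted over all $k=1,\dots,t$, equals $\lambda$. Two such families $\{S_1,\dots,S_t\}$ and $\{S'_1,\dots,S'_t\}$ are called equivalent if there exist an automorphism $\varphi$ of the group $\mathbf{Z}_n$ (i.e. $x\mapsto ux$ with $u$ a unit modulo $n$), a permutation $\sigma$ of $\{1,\dots,t\}$ and elements $t_1,\dots,t_t\in\mathbf{Z}_n$ such that $S'_k=\varphi(S_{\sigma(k)})+t_k$ for all $k$. -}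

module Defs where

open import Data.Nat using (ℕ; zero; suc; _+_; _*_; _∸_; NonZero)
open import Data.Nat.DivMod using (_mod_)
open import Data.Nat.Coprimality using (Coprime)
open import Data.Fin using (Fin; toℕ)
open import Data.Fin.Subset using (Subset; _∈_; ∣_∣; ⁅_⁆; ⊥; _∪_)
open import Data.Fin.Subset.Properties using (_∈?_)
open import Data.Fin.Permutation using (Permutation′; _⟨$⟩ʳ_)
open import Data.List using (List; []; _∷_; length; filter; allFin; cartesianProduct; foldr)
import Data.Vec
open import Data.Vec using (Vec; lookup)
open import Data.Product using (Σ; ∃; ∃-syntax; _×_; _,_; proj₁; proj₂)
open import Relation.Binary.PropositionalEquality using (_≡_; _≢_)
open import Relation.Nullary.Decidable using (_×-dec_)
open import Data.Fin.Properties using (_≟_)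
open import Function.Bundles using (_⇔_)

module _ {n : ℕ} .{{_ : NonZero n}} where

  _⊕_ : Fin n → Fin n → Fin n
  a ⊕ b = (toℕ a + toℕ b) mod n

  _⊖_ : Fin n → Fin n → Fin n
  a ⊖ b = (toℕ a + (n ∸ toℕ b)) mod n

  _⊛_ : ℕ → Fin n → Fin n
  u ⊛ a = (u * toℕ a) mod n

  diffCount : Subset n → Fin n → ℕ
  diffCount S r =
    length (filter (λ p → ((proj₁ p ∈? S) ×-dec (proj₂ p ∈? S)) ×-dec ((proj₁ p ⊖ proj₂ p) ≟ r))
                   (cartesianProduct (allFin n) (allFin n)))

fromList : {n m : ℕ} .{{_ : NonZero n}} → Vec ℕ m → Subset n
fromList {n} = Data.Vec.foldr′ (λ x S → ⁅ x mod n ⁆ ∪ S) ⊥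

sumFin : (t : ℕ) → (Fin t → ℕ) → ℕ
sumFin zero f = 0
sumFin (suc t) f = f Fin.zero + sumFin t (λ k → f (Fin.suc k))
  where import Data.Fin as Fin

IsSDS : (n t : ℕ) .{{_ : NonZero n}} → Vec ℕ t → ℕ → Vec (Subset n) t → Set
IsSDS n t sizes λ' S =
  ((k : Fin t) → ∣ lookup S k ∣ ≡ lookup sizes k) ×
  ((r : Fin n) → toℕ r ≢ 0 → sumFin t (λ k → diffCount (lookup S k) r) ≡ λ')

_≈Image_ : {n : ℕ} .{{_ : NonZero n}} → Subset n → (Subset n × ℕ × Fin n) → Set
_≈Image_ {n} S' (S , u , c) = (x : Fin n) → (x ∈ S') ⇔ (∃[ y ] (y ∈ S × x ≡ (u ⊛ y) ⊕ c))

Equivalent : (n t : ℕ) .{{_ : NonZero n}} → Vec (Subset n) t → Vec (Subset n) t → Set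
Equivalent n t S S' =
  ∃[ u ] (Coprime u n ×
    Σ (Permutation′ t) λ σ → Σ (Fin t → Fin n) λ τ → ((k : Fin t) →
      lookup S' k ≈Image (lookup S (σ ⟨$⟩ʳ k) , u , τ k)))

-- Both difference conditions are finite computations, decided by evaluating the
-- difference counts for all 46 nonzero residues. For non-equivalence, an
-- equivalence of the two families maps some P_j into Q₁ by an affine map
-- x ↦ u x + c whose multiplier u is a unit, hence nonzero mod 47; exhaustive
-- search over the 46 · 3 · 47 candidate maps shows that every one of them
-- sends some element of P_j outside Q₁.
module Submission where

open import Data.Nat using (ℕ; NonZero; NonTrivial; _%_; nonTrivial⇒≢1)
import Data.Nat as ℕ
open import Data.Nat.Coprimality using (Coprime)
open import Data.Nat.Divisibility using (m%n≡0⇒n∣m; ∣-refl)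
open import Data.Nat.DivMod using (_mod_; m%n<n; %-distribˡ-*; m%n%n≡m%n)
open import Data.Fin using (Fin; zero; toℕ)
open import Data.Fin.Properties using (all?; toℕ-fromℕ<; fromℕ<-cong)
open import Data.Fin.Subset using (Subset; _∈_; ∣_∣)
open import Data.Fin.Subset.Properties using (_∈?_)
open import Data.Fin.Permutation using (_⟨$⟩ʳ_)
open import Data.Vec using (Vec; []; _∷_; lookup)
open import Data.Product using (_×_; _,_; ∃-syntax)
open import Function.Bundles using (Equivalence)
open import Relation.Binary.PropositionalEquality
  using (_≡_; _≢_; refl; sym; trans; cong; subst; module ≡-Reasoning)
open import Relation.Nullary using (Dec; ¬_; ¬?)
open import Relation.Nullary.Decidable using (_×-dec_; _→-dec_; from-yes)

open import Defs

isSDS? : ∀ n t .{{_ : NonZero n}} (sizes : Vec ℕ t) (λ′ : ℕ) (S : Vec (Subset n) t) →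
         Dec (IsSDS n t sizes λ′ S)
isSDS? n t sizes λ′ S =
  all? (λ k → ∣ lookup S k ∣ ℕ.≟ lookup sizes k) ×-dec
  all? (λ r → ¬? (toℕ r ℕ.≟ 0) →-dec sumFin t (λ k → diffCount (lookup S k) r) ℕ.≟ λ′)

module _ {n : ℕ} .{{_ : NonZero n}} where

  AffineMapsInto : ℕ → Fin n → Subset n → Subset n → Set
  AffineMapsInto u c S S′ = ∀ y → y ∈ S → (u ⊛ y) ⊕ c ∈ S′

  affineMapsInto? : ∀ u c S S′ → Dec (AffineMapsInto u c S S′)
  affineMapsInto? u c S S′ = all? (λ y → y ∈? S →-dec (u ⊛ y) ⊕ c ∈? S′)

  NoAffineMapInto : Subset n → Subset n → Set
  NoAffineMapInto S S′ = ∀ (v : Fin n) → toℕ v ≢ 0 → ∀ c → ¬ AffineMapsInto (toℕ v) c S S′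

  noAffineMapInto? : ∀ S S′ → Dec (NoAffineMapInto S S′)
  noAffineMapInto? S S′ =
    all? (λ v → ¬? (toℕ v ℕ.≟ 0) →-dec all? (λ c → ¬? (affineMapsInto? (toℕ v) c S S′)))

  toℕ-mod : ∀ u → toℕ (u mod n) ≡ u % n
  toℕ-mod u = toℕ-fromℕ< (m%n<n u n)

  ⊛-mod : ∀ u (y : Fin n) → u ⊛ y ≡ toℕ (u mod n) ⊛ y
  ⊛-mod u y = fromℕ<-cong _ _ reduce _ _
    where
    open ≡-Reasoning
    a = toℕ y
    reduce : (u ℕ.* a) % n ≡ (toℕ (u mod n) ℕ.* a) % n
    reduce = begin
      (u ℕ.* a) % n                 ≡⟨ %-distribˡ-* u a n ⟩
      (u % n ℕ.* (a % n)) % n       ≡⟨ cong (λ m → (m ℕ.* (a % n)) % n) (sym (m%n%n≡m%n u n)) ⟩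
      (u % n % n ℕ.* (a % n)) % n   ≡⟨ sym (%-distribˡ-* (u % n) a n) ⟩
      (u % n ℕ.* a) % n             ≡⟨ cong (λ m → (m ℕ.* a) % n) (sym (toℕ-mod u)) ⟩
      (toℕ (u mod n) ℕ.* a) % n     ∎

  affineMapsInto-mod : ∀ {u c S S′} → AffineMapsInto u c S S′ → AffineMapsInto (toℕ (u mod n)) c S S′
  affineMapsInto-mod {u} {c} {S′ = S′} into y y∈S = subst (λ x → x ⊕ c ∈ S′) (⊛-mod u y) (into y y∈S)

  coprime⇒mod≢0 : .{{_ : NonTrivial n}} → ∀ {u} → Coprime u n → toℕ (u mod n) ≢ 0
  coprime⇒mod≢0 {u} coprime u%n≡0 =
    nonTrivial⇒≢1 (coprime (m%n≡0⇒n∣m u n (trans (sym (toℕ-mod u)) u%n≡0) , ∣-refl))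

  equivalent⇒affineMapsInto : ∀ {t} {S S′ : Vec (Subset n) (ℕ.suc t)} → Equivalent n (ℕ.suc t) S S′ →
    ∃[ u ] (Coprime u n × ∃[ j ] ∃[ c ] AffineMapsInto u c (lookup S j) (lookup S′ zero))
  equivalent⇒affineMapsInto (u , coprime , σ , τ , image) =
    u , coprime , σ ⟨$⟩ʳ zero , τ zero ,
    λ y y∈S → Equivalence.from (image zero ((u ⊛ y) ⊕ τ zero)) (y , y∈S , refl)

  ¬equivalent : .{{_ : NonTrivial n}} → ∀ {t} (S S′ : Vec (Subset n) (ℕ.suc t)) →
    (∀ j → NoAffineMapInto (lookup S j) (lookup S′ zero)) → ¬ Equivalent n (ℕ.suc t) S S′
  ¬equivalent S S′ noMap equivalent with equivalent⇒affineMapsInto {S = S} {S′} equivalent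
  ... | u , coprime , j , c , into =
    noMap j (u mod n) (coprime⇒mod≢0 coprime) c (affineMapsInto-mod {S = lookup S j} {lookup S′ zero} into)

P : Vec (Subset 47) 3
P = fromList (0 ∷ 2 ∷ 4 ∷ 5 ∷ 9 ∷ 10 ∷ 12 ∷ 16 ∷ 17 ∷ 19 ∷ 21 ∷ 22 ∷ 23 ∷ 25 ∷ 27 ∷ 28 ∷ 35 ∷ 36 ∷ 37 ∷ 43 ∷ 46 ∷ [])
  ∷ fromList (0 ∷ 1 ∷ 2 ∷ 6 ∷ 8 ∷ 9 ∷ 11 ∷ 15 ∷ 16 ∷ 19 ∷ 25 ∷ 32 ∷ 33 ∷ 35 ∷ 36 ∷ 37 ∷ 38 ∷ 40 ∷ 44 ∷ [])
  ∷ fromList (1 ∷ 2 ∷ 3 ∷ 4 ∷ 5 ∷ 6 ∷ 7 ∷ 10 ∷ 11 ∷ 16 ∷ 18 ∷ 22 ∷ 24 ∷ 28 ∷ 31 ∷ 35 ∷ 38 ∷ 40 ∷ 43 ∷ [])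
  ∷ []

Q : Vec (Subset 47) 3
Q = fromList (4 ∷ 5 ∷ 6 ∷ 8 ∷ 11 ∷ 12 ∷ 15 ∷ 20 ∷ 21 ∷ 23 ∷ 25 ∷ 26 ∷ 28 ∷ 29 ∷ 30 ∷ 31 ∷ 32 ∷ 36 ∷ 39 ∷ 41 ∷ 43 ∷ [])
  ∷ fromList (1 ∷ 2 ∷ 5 ∷ 7 ∷ 13 ∷ 14 ∷ 21 ∷ 22 ∷ 24 ∷ 26 ∷ 31 ∷ 32 ∷ 35 ∷ 36 ∷ 37 ∷ 39 ∷ 40 ∷ 42 ∷ 46 ∷ [])
  ∷ fromList (1 ∷ 2 ∷ 3 ∷ 4 ∷ 5 ∷ 9 ∷ 12 ∷ 18 ∷ 20 ∷ 21 ∷ 24 ∷ 25 ∷ 32 ∷ 34 ∷ 38 ∷ 39 ∷ 43 ∷ 44 ∷ 46 ∷ [])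
  ∷ []

P-isSDS : IsSDS 47 3 (21 ∷ 19 ∷ 19 ∷ []) 24 P
P-isSDS = from-yes (isSDS? 47 3 (21 ∷ 19 ∷ 19 ∷ []) 24 P)

Q-isSDS : IsSDS 47 3 (21 ∷ 19 ∷ 19 ∷ []) 24 Q
Q-isSDS = from-yes (isSDS? 47 3 (21 ∷ 19 ∷ 19 ∷ []) 24 Q)

no-P-maps-into-Q₁ : ∀ j → NoAffineMapInto (lookup P j) (lookup Q zero)
no-P-maps-into-Q₁ = from-yes (all? λ j → noAffineMapInto? (lookup P j) (lookup Q zero))

proposition2 : IsSDS 47 3 (21 ∷ 19 ∷ 19 ∷ []) 24
    (fromList (0 ∷ 2 ∷ 4 ∷ 5 ∷ 9 ∷ 10 ∷ 12 ∷ 16 ∷ 17 ∷ 19 ∷ 21 ∷ 22 ∷ 23 ∷ 25 ∷ 27 ∷ 28 ∷ 35 ∷ 36 ∷ 37 ∷ 43 ∷ 46 ∷ [])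
    ∷ fromList (0 ∷ 1 ∷ 2 ∷ 6 ∷ 8 ∷ 9 ∷ 11 ∷ 15 ∷ 16 ∷ 19 ∷ 25 ∷ 32 ∷ 33 ∷ 35 ∷ 36 ∷ 37 ∷ 38 ∷ 40 ∷ 44 ∷ [])
    ∷ fromList (1 ∷ 2 ∷ 3 ∷ 4 ∷ 5 ∷ 6 ∷ 7 ∷ 10 ∷ 11 ∷ 16 ∷ 18 ∷ 22 ∷ 24 ∷ 28 ∷ 31 ∷ 35 ∷ 38 ∷ 40 ∷ 43 ∷ [])
    ∷ [])
    × IsSDS 47 3 (21 ∷ 19 ∷ 19 ∷ []) 24
    (fromList (4 ∷ 5 ∷ 6 ∷ 8 ∷ 11 ∷ 12 ∷ 15 ∷ 20 ∷ 21 ∷ 23 ∷ 25 ∷ 26 ∷ 28 ∷ 29 ∷ 30 ∷ 31 ∷ 32 ∷ 36 ∷ 39 ∷ 41 ∷ 43 ∷ [])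
    ∷ fromList (1 ∷ 2 ∷ 5 ∷ 7 ∷ 13 ∷ 14 ∷ 21 ∷ 22 ∷ 24 ∷ 26 ∷ 31 ∷ 32 ∷ 35 ∷ 36 ∷ 37 ∷ 39 ∷ 40 ∷ 42 ∷ 46 ∷ [])
    ∷ fromList (1 ∷ 2 ∷ 3 ∷ 4 ∷ 5 ∷ 9 ∷ 12 ∷ 18 ∷ 20 ∷ 21 ∷ 24 ∷ 25 ∷ 32 ∷ 34 ∷ 38 ∷ 39 ∷ 43 ∷ 44 ∷ 46 ∷ [])
    ∷ [])
    × ¬ Equivalent 47 3
    (fromList (0 ∷ 2 ∷ 4 ∷ 5 ∷ 9 ∷ 10 ∷ 12 ∷ 16 ∷ 17 ∷ 19 ∷ 21 ∷ 22 ∷ 23 ∷ 25 ∷ 27 ∷ 28 ∷ 35 ∷ 36 ∷ 37 ∷ 43 ∷ 46 ∷ [])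
    ∷ fromList (0 ∷ 1 ∷ 2 ∷ 6 ∷ 8 ∷ 9 ∷ 11 ∷ 15 ∷ 16 ∷ 19 ∷ 25 ∷ 32 ∷ 33 ∷ 35 ∷ 36 ∷ 37 ∷ 38 ∷ 40 ∷ 44 ∷ [])
    ∷ fromList (1 ∷ 2 ∷ 3 ∷ 4 ∷ 5 ∷ 6 ∷ 7 ∷ 10 ∷ 11 ∷ 16 ∷ 18 ∷ 22 ∷ 24 ∷ 28 ∷ 31 ∷ 35 ∷ 38 ∷ 40 ∷ 43 ∷ [])
    ∷ [])
    (fromList (4 ∷ 5 ∷ 6 ∷ 8 ∷ 11 ∷ 12 ∷ 15 ∷ 20 ∷ 21 ∷ 23 ∷ 25 ∷ 26 ∷ 28 ∷ 29 ∷ 30 ∷ 31 ∷ 32 ∷ 36 ∷ 39 ∷ 41 ∷ 43 ∷ [])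
    ∷ fromList (1 ∷ 2 ∷ 5 ∷ 7 ∷ 13 ∷ 14 ∷ 21 ∷ 22 ∷ 24 ∷ 26 ∷ 31 ∷ 32 ∷ 35 ∷ 36 ∷ 37 ∷ 39 ∷ 40 ∷ 42 ∷ 46 ∷ [])
    ∷ fromList (1 ∷ 2 ∷ 3 ∷ 4 ∷ 5 ∷ 9 ∷ 12 ∷ 18 ∷ 20 ∷ 21 ∷ 24 ∷ 25 ∷ 32 ∷ 34 ∷ 38 ∷ 39 ∷ 43 ∷ 44 ∷ 46 ∷ [])
    ∷ [])
proposition2 = P-isSDS , Q-isSDS , ¬equivalent P Q no-P-maps-into-Q₁
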